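{- For every graph $G$ and every $n\ge1$, there is an equivariant simplicial map $\iota_n\colon \mathrm{Hom}(K_2,G)^n\to\mathrm{Hom}(K_2,G^n)$.
   Context: Graphs are finite, undirected, viewed as symmetric relations, loops allowed. $G^n$ is the $n$-fold categorical product: vertices $V(G)^n$, with $(u,v)$ an edge iff $(u_i,v_i)\in E(G)$ for all $i$. A multihomomorphism $m\colon K_2\to H$ is a pair of nonempty subsets $m(1),m(2)\subseteq V(H)$ with $m(1)\times m(2)\subseteq E(H)$, partially ordered by componentwise inclusion. $\mathrm{Hom}(K_2,H)$ is the order complex of this poset (simplicial set whose $k$-simplices are weakly increasing chains of length $k+1$, with operations given by omitting/repeating entries in order), with $\mathbb Z_2$-action swapping $m(1)$ and $m(2)$. Products of simplicial sets are taken componentwise ($(X\times Y)_k=X_k\times Y_k$) with the diagonal $\mathbb Z_2$-action; a simplicial map is equivariant if it commutes with the actions. -}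

module Defs where

open import Data.Nat using (ℕ; suc)
open import Data.Fin using (Fin) renaming (_≤_ to _≤ᶠ_)
open import Data.Bool using (Bool; T)
open import Data.Product using (Σ; ∃; _×_; _,_; proj₁; proj₂)
open import Relation.Binary.PropositionalEquality using (_≡_)

-- A graph: vertex type with a symmetric edge relation (loops allowed).
-- Finite graphs are those with vertex type Fin k (see graphOn).
record Graph : Set₁ where
  field
    V   : Set
    E   : V → V → Set
    sym : ∀ {x y} → E x y → E y x
open Graph public

graphOn : (k : ℕ) (E : Fin k → Fin k → Set) → (∀ {x y} → E x y → E y x) → Graph
graphOn k E s = record { V = Fin k ; E = E ; sym = s }

_^ᴳ_ : Graph → ℕ → Graph
G ^ᴳ n = record
  { V   = Fin n → V G
  ; E   = λ u v → ∀ i → E G (u i) (v i)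
  ; sym = λ e i → sym G (e i) }

Subset : Set → Set
Subset A = A → Bool

_⊆_ : {A : Set} → Subset A → Subset A → Set
S ⊆ S' = ∀ x → T (S x) → T (S' x)

Nonempty : {A : Set} → Subset A → Set
Nonempty {A} S = Σ A λ x → T (S x)

-- Multihomomorphisms K₂ → H.
record MultiHom (H : Graph) : Set where
  field
    m₁   : Subset (V H)
    m₂   : Subset (V H)
    ne₁  : Nonempty m₁
    ne₂  : Nonempty m₂
    edge : ∀ x y → T (m₁ x) → T (m₂ y) → E H x y
open MultiHom public

_≼_ : {H : Graph} → MultiHom H → MultiHom H → Set
m ≼ m' = (m₁ m ⊆ m₁ m') × (m₂ m ⊆ m₂ m')

swapᴹ : {H : Graph} → MultiHom H → MultiHom H
swapᴹ {H} m = record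
  { m₁ = m₂ m ; m₂ = m₁ m ; ne₁ = ne₂ m ; ne₂ = ne₁ m
  ; edge = λ x y p q → sym H (edge m y x q p) }

-- k-simplices of Hom(K₂,H): weakly increasing chains m₀ ≼ … ≼ m_k.
record Simplex (H : Graph) (k : ℕ) : Set where
  field
    chain : Fin (suc k) → MultiHom H
    mono  : ∀ {i j} → i ≤ᶠ j → chain i ≼ chain j
open Simplex public

-- Simplices are determined by their underlying chain of pairs of subsets.
_≈ˢ_ : {H : Graph} {k : ℕ} → Simplex H k → Simplex H k → Set
σ ≈ˢ τ = ∀ i x → (m₁ (chain σ i) x ≡ m₁ (chain τ i) x) × (m₂ (chain σ i) x ≡ m₂ (chain τ i) x)

-- Simplicial operators: monotone maps [j] → [k] (generated by omitting/repeating entries).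
Monotone : {j k : ℕ} → (Fin (suc j) → Fin (suc k)) → Set
Monotone θ = ∀ {a b} → a ≤ᶠ b → θ a ≤ᶠ θ b

act : {H : Graph} {j k : ℕ} (θ : Fin (suc j) → Fin (suc k)) → Monotone θ →
      Simplex H k → Simplex H j
act θ mθ σ = record { chain = λ i → chain σ (θ i) ; mono = λ p → mono σ (mθ p) }

swapˢ : {H : Graph} {k : ℕ} → Simplex H k → Simplex H k
swapˢ σ = record { chain = λ i → swapᴹ (chain σ i)
                 ; mono = λ p → proj₂ (mono σ p) , proj₁ (mono σ p) }

-- k-simplices of the n-fold product Hom(K₂,G)^n (componentwise, diagonal action).
ProdSimplex : Graph → ℕ → ℕ → Set
ProdSimplex G n k = Fin n → Simplex G k

record EquivariantSimplicialMap (G : Graph) (n : ℕ) : Set where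
  field
    map       : ∀ k → ProdSimplex G n k → Simplex (G ^ᴳ n) k
    respects  : ∀ k (σs τs : ProdSimplex G n k) → (∀ i → σs i ≈ˢ τs i) →
                map k σs ≈ˢ map k τs
    simplicial : ∀ j k (θ : Fin (suc j) → Fin (suc k)) (mθ : Monotone θ)
                 (σs : ProdSimplex G n k) →
                 map j (λ i → act θ mθ (σs i)) ≈ˢ act θ mθ (map k σs)
    equivariant : ∀ k (σs : ProdSimplex G n k) →
                  map k (λ i → swapˢ (σs i)) ≈ˢ swapˢ (map k σs)

-- The map sends an n-tuple of chains (m^i_0 ≼ … ≼ m^i_k), i < n, to the single chain whose
-- j-th entry is the product multihomomorphism (∏ᵢ m^i_j(1), ∏ᵢ m^i_j(2)) into G^n. Products of
-- nonempty sets are nonempty, a product of edges is an edge of G^n, and products are monotone,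
-- so this is a chain; simplicial operators and the swap act levelwise resp. factorwise, so they
-- commute with taking products on the nose.
module Submission where

open import Defs
open import Data.Nat using (ℕ; suc; _≤_)
open import Data.Fin using (Fin)
open import Data.Fin.Properties using (all?)
open import Data.Bool using (Bool; true; false; T)
open import Data.Empty using (⊥-elim)
open import Data.Unit using (tt)
open import Data.Product using (_,_; proj₁; proj₂)
open import Relation.Nullary.Decidable using (⌊_⌋; T?; toWitness; fromWitness)
open import Relation.Binary.PropositionalEquality using (_≡_; _≗_; refl; subst)
  renaming (sym to ≡-sym)

T-⇔⇒≡ : ∀ {a b} → (T a → T b) → (T b → T a) → a ≡ b
T-⇔⇒≡ {false} {false} _   _   = refl
T-⇔⇒≡ {false} {true}  _   b⇒a = ⊥-elim (b⇒a tt)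
T-⇔⇒≡ {true}  {false} a⇒b _   = ⊥-elim (a⇒b tt)
T-⇔⇒≡ {true}  {true}  _   _   = refl

module _ {n : ℕ} where

  allᵇ : (Fin n → Bool) → Bool
  allᵇ b = ⌊ all? (λ i → T? (b i)) ⌋

  allᵇ-intro : ∀ {b} → (∀ i → T (b i)) → T (allᵇ b)
  allᵇ-intro = fromWitness

  allᵇ-elim : ∀ {b} → T (allᵇ b) → ∀ i → T (b i)
  allᵇ-elim = toWitness

  allᵇ-cong : ∀ {b b′} → b ≗ b′ → allᵇ b ≡ allᵇ b′
  allᵇ-cong b≗b′ = T-⇔⇒≡
    (λ p → allᵇ-intro (λ i → subst T (b≗b′ i) (allᵇ-elim p i)))
    (λ p → allᵇ-intro (λ i → subst T (≡-sym (b≗b′ i)) (allᵇ-elim p i)))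

module _ {A : Set} {n : ℕ} where

  prodSubset : (Fin n → Subset A) → Subset (Fin n → A)
  prodSubset S u = allᵇ (λ i → S i (u i))

  prodSubset-nonempty : ∀ {S : Fin n → Subset A} → (∀ i → Nonempty (S i)) →
                        Nonempty (prodSubset S)
  prodSubset-nonempty ne = (λ i → proj₁ (ne i)) , allᵇ-intro (λ i → proj₂ (ne i))

  prodSubset-mono : ∀ {S S′ : Fin n → Subset A} → (∀ i → S i ⊆ S′ i) →
                    prodSubset S ⊆ prodSubset S′
  prodSubset-mono S⊆S′ u p = allᵇ-intro (λ i → S⊆S′ i (u i) (allᵇ-elim p i))

module _ {G : Graph} {n : ℕ} where

  prodMultiHom : (Fin n → MultiHom G) → MultiHom (G ^ᴳ n)
  prodMultiHom ms = record
    { m₁   = prodSubset (λ i → m₁ (ms i))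
    ; m₂   = prodSubset (λ i → m₂ (ms i))
    ; ne₁  = prodSubset-nonempty (λ i → ne₁ (ms i))
    ; ne₂  = prodSubset-nonempty (λ i → ne₂ (ms i))
    ; edge = λ u v p q i → edge (ms i) (u i) (v i) (allᵇ-elim p i) (allᵇ-elim q i)
    }

  prodMultiHom-mono : ∀ {ms ms′ : Fin n → MultiHom G} → (∀ i → ms i ≼ ms′ i) →
                      prodMultiHom ms ≼ prodMultiHom ms′
  prodMultiHom-mono ms≼ms′ = prodSubset-mono (λ i → proj₁ (ms≼ms′ i))
                           , prodSubset-mono (λ i → proj₂ (ms≼ms′ i))

  prodSimplex : ∀ {k} → ProdSimplex G n k → Simplex (G ^ᴳ n) k
  prodSimplex {k} σs = record
    { chain = λ j → prodMultiHom (level j)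
    ; mono  = λ {j} {j′} j≤j′ →
        prodMultiHom-mono {level j} {level j′} (λ i → mono (σs i) j≤j′)
    }
    where
    level : Fin (suc k) → Fin n → MultiHom G
    level j i = chain (σs i) j

  prodSimplex-cong : ∀ {k} (σs τs : ProdSimplex G n k) → (∀ i → σs i ≈ˢ τs i) →
                     prodSimplex σs ≈ˢ prodSimplex τs
  prodSimplex-cong σs τs σs≈τs j u = allᵇ-cong (λ i → proj₁ (σs≈τs i j (u i)))
                                   , allᵇ-cong (λ i → proj₂ (σs≈τs i j (u i)))

ι : (G : Graph) (n : ℕ) → EquivariantSimplicialMap G n
ι G n = record
  { map         = λ k → prodSimplex
  ; respects    = λ k → prodSimplex-cong
  ; simplicial  = λ j k θ mθ σs i x → refl , refl
  ; equivariant = λ k σs i x → refl , refl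
  }

lemma3p2 : (k : ℕ) (E : Fin k → Fin k → Set) (s : ∀ {x y} → E x y → E y x)
           (n : ℕ) → 1 ≤ n → EquivariantSimplicialMap (graphOn k E s) n
lemma3p2 k E s n _ = ι (graphOn k E s) n
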